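{- For every integer $n\ge 4$, the independence number of $C_n(1,3)$ is $\alpha(C_n(1,3))=n/2$ if $n$ is even and $\alpha(C_n(1,3))=(n-3)/2$ if $n$ is odd.
   Context: $C_n(1,3)$ is the simple graph with vertex set $\{1,\dots,n\}$ in which distinct vertices $i,j$ are adjacent iff $i-j\equiv \pm1$ or $\pm 3 \pmod n$. $\alpha(G)$ denotes the maximum size of an independent set of $G$. -}

module Defs where

open import Data.Nat using (ℕ; suc; _+_; _≤_; _%_; NonZero)
open import Data.Fin using (Fin; toℕ)
open import Data.Fin.Subset using (Subset; _∈_; ∣_∣)
open import Data.Product using (_×_; Σ)
open import Data.Sum using (_⊎_)
open import Relation.Nullary using (¬_)
open import Relation.Binary.PropositionalEquality using (_≡_; _≢_)

-- Vertices of C_n(1,3) are Fin n (representing 1..n as 0..n-1).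
-- i ~ j  iff  i ≠ j and  j - i ≡ ±1 or ±3 (mod n).
-- "j - i ≡ d (mod n)" is expressed as (i + d) mod n = j.
StepBy : (n d : ℕ) → .{{NonZero n}} → Fin n → Fin n → Set
StepBy n d i j = (toℕ i + d) % n ≡ toℕ j

Adj13 : (n : ℕ) → .{{NonZero n}} → Fin n → Fin n → Set
Adj13 n i j = i ≢ j × (StepBy n 1 i j ⊎ StepBy n 1 j i ⊎ StepBy n 3 i j ⊎ StepBy n 3 j i)

Independent : (n : ℕ) → .{{NonZero n}} → Subset n → Set
Independent n S = ∀ i j → i ∈ S → j ∈ S → ¬ Adj13 n i j

IndependenceNumber13 : (n : ℕ) → .{{NonZero n}} → ℕ → Set
IndependenceNumber13 n k =
  Σ (Subset n) (λ S → Independent n S × ∣ S ∣ ≡ k)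
  × (∀ (S : Subset n) → Independent n S → ∣ S ∣ ≤ k)

open import Data.Nat using (_*_)
open import Data.Product using (∃)

Even : ℕ → Set
Even n = ∃ λ k → n ≡ 2 * k

Odd : ℕ → Set
Odd n = ∃ λ k → n ≡ 1 + 2 * k

-- Let D count the double zeros of an independent set S, the cyclic positions i with i, i + 1 ∉ S.
-- No two consecutive vertices lie in S, so each of the n pairs (i, i + 1) contains exactly one
-- element of S unless it is a double zero; hence 2∣S∣ + D = n and ∣S∣ ≤ n / 2. A double zero at
-- i + 1 whose neighbours i and i + 2 are not double zeros forces i, i + 3 ∈ S, which is forbidden;
-- so double zeros are never isolated and D ≠ 1. For odd n, D is odd, hence D ≥ 3 and
-- ∣S∣ ≤ (n − 3) / 2. The even vertices below 2k attain both bounds.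
module Submission where

open import Defs
open import Data.Bool using (Bool; true; false; not; _∧_; _∨_)
open import Data.Fin using (Fin; toℕ)
import Data.Fin as Fin
open import Data.Fin.Properties using (toℕ-fromℕ<)
open import Data.Fin.Subset using (Subset; _∈_; ∣_∣; ⊥; inside; outside)
open import Data.Fin.Subset.Properties using (∣⊥∣≡0; ∉⊥)
open import Data.Nat
open import Data.Nat.DivMod
open import Data.Nat.Divisibility
  using (_∣_; _∤_; _∣0; ∣-refl; ∣m∣n⇒∣m+n; ∣m+n∣m⇒∣n; m%n≡0⇒n∣m; n∣m⇒m%n≡0; divides)
open import Data.Nat.Properties
open import Algebra.Properties.CommutativeSemigroup +-commutativeSemigroup
  using (interchange; xy∙z≈xz∙y; x∙yz≈yx∙z)
open import Data.Product using (_×_; _,_; ∃-syntax)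
open import Data.Sum using (_⊎_; inj₁; inj₂; map₂)
open import Data.Vec using (Vec; []; _∷_; lookup; here; there)
open import Data.Vec.Properties using (lookup⇒[]=)
open import Function using (_∘_)
open import Relation.Nullary using (¬_; yes; no; contradiction)
open import Relation.Binary.PropositionalEquality

∑< : ℕ → (ℕ → ℕ) → ℕ
∑< zero    f = 0
∑< (suc n) f = ∑< n f + f n

∑<-cong : ∀ n {f g : ℕ → ℕ} → (∀ {i} → i < n → f i ≡ g i) → ∑< n f ≡ ∑< n g
∑<-cong zero    eq = refl
∑<-cong (suc n) eq = cong₂ _+_ (∑<-cong n (eq ∘ m<n⇒m<1+n)) (eq ≤-refl)

∑<-distrib-+ : ∀ n (f g : ℕ → ℕ) → ∑< n (λ i → f i + g i) ≡ ∑< n f + ∑< n g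
∑<-distrib-+ zero    f g = refl
∑<-distrib-+ (suc n) f g =
  trans (cong (_+ (f n + g n)) (∑<-distrib-+ n f g)) (interchange (∑< n f) (∑< n g) (f n) (g n))

∑<-const : ∀ n c → ∑< n (λ _ → c) ≡ n * c
∑<-const zero    c = refl
∑<-const (suc n) c = trans (cong (_+ c) (∑<-const n c)) (+-comm (n * c) c)

∑<-monoˡ-≤ : ∀ {m n} (f : ℕ → ℕ) → m ≤ n → ∑< m f ≤ ∑< n f
∑<-monoˡ-≤ {m} {zero}  f z≤n = ≤-refl
∑<-monoˡ-≤ {m} {suc n} f m≤1+n with m≤n⇒m<n∨m≡n m≤1+n
... | inj₁ m<1+n = ≤-trans (∑<-monoˡ-≤ f (s≤s⁻¹ m<1+n)) (m≤m+n (∑< n f) (f n))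
... | inj₂ refl  = ≤-refl

∑<-shift : ∀ n (f : ℕ → ℕ) → ∑< n (f ∘ suc) + f 0 ≡ ∑< n f + f n
∑<-shift zero    f = refl
∑<-shift (suc n) f = begin
  ∑< n (f ∘ suc) + f (suc n) + f 0  ≡⟨ xy∙z≈xz∙y (∑< n (f ∘ suc)) (f (suc n)) (f 0) ⟩
  ∑< n (f ∘ suc) + f 0 + f (suc n)  ≡⟨ cong (_+ f (suc n)) (∑<-shift n f) ⟩
  ∑< n f + f n + f (suc n)          ∎
  where open ≡-Reasoning

∑<-suc : ∀ n (f : ℕ → ℕ) → ∑< (suc n) f ≡ f 0 + ∑< n (f ∘ suc)
∑<-suc n f = trans (sym (∑<-shift n f)) (+-comm (∑< n (f ∘ suc)) (f 0))

∑<-pos⇒∃ : ∀ n (f : ℕ → ℕ) → 0 < ∑< n f → ∃[ i ] i < n × 0 < f i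
∑<-pos⇒∃ (suc n) f pos with f n in fn≡
... | suc _ = n , ≤-refl , subst (0 <_) (sym fn≡) z<s
... | zero with ∑<-pos⇒∃ n f (subst (0 <_) (+-identityʳ (∑< n f)) pos)
...   | i , i<n , 0<fi = i , m<n⇒m<1+n i<n , 0<fi

Periodic : {A : Set} → ℕ → (ℕ → A) → Set
Periodic n f = ∀ i → f (i + n) ≡ f i

∑<-shift-periodic : ∀ n (f : ℕ → ℕ) → f n ≡ f 0 → ∑< n (f ∘ suc) ≡ ∑< n f
∑<-shift-periodic n f fn≡f0 =
  +-cancelʳ-≡ (f 0) _ _ (trans (∑<-shift n f) (cong (∑< n f +_) fn≡f0))

∑<-rotate : ∀ n {f : ℕ → ℕ} → Periodic n f → ∀ m → ∑< n (λ k → f (k + m)) ≡ ∑< n f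
∑<-rotate n {f} periodic zero    = ∑<-cong n (λ {k} _ → cong f (+-identityʳ k))
∑<-rotate n {f} periodic (suc m) = begin
  ∑< n (λ k → f (k + suc m))  ≡⟨ ∑<-cong n (λ {k} _ → cong f (+-suc k m)) ⟩
  ∑< n (λ k → f (suc k + m))  ≡⟨ ∑<-shift-periodic n (λ k → f (k + m))
                                   (trans (cong f (+-comm n m)) (periodic m)) ⟩
  ∑< n (λ k → f (k + m))      ≡⟨ ∑<-rotate n periodic m ⟩
  ∑< n f                      ∎
  where open ≡-Reasoning

indicator : Bool → ℕ
indicator true  = 1
indicator false = 0

indicator-partition : ∀ a b → a ∧ b ≡ false →
  indicator a + indicator b + indicator (not (a ∨ b)) ≡ 1
indicator-partition false false _ = refl
indicator-partition false true  _ = refl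
indicator-partition true  false _ = refl
indicator-partition true  true  ()

indicator-nor-≤ : ∀ a b c d → a ∧ d ≡ false →
  indicator (not (b ∨ c)) ≤ indicator (not (a ∨ b)) + indicator (not (c ∨ d))
indicator-nor-≤ _     true  _     _     _  = z≤n
indicator-nor-≤ _     false true  _     _  = z≤n
indicator-nor-≤ false false false _     _  = s≤s z≤n
indicator-nor-≤ true  false false false _  = s≤s z≤n
indicator-nor-≤ true  false false true  ()

2*m+n≡1+2*o⇒n≢1⇒3≤n : ∀ m n o → 2 * m + n ≡ 1 + 2 * o → n ≢ 1 → 3 ≤ n
2*m+n≡1+2*o⇒n≢1⇒3≤n m zero o eq _ =
  contradiction (trans (sym (+-identityʳ (2 * m))) eq) (even≢odd m o)
2*m+n≡1+2*o⇒n≢1⇒3≤n m 1 o _ n≢1 = contradiction refl n≢1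
2*m+n≡1+2*o⇒n≢1⇒3≤n m 2 o eq _ =
  contradiction (trans (trans (cong (2 *_) (+-comm 1 m)) (*-distribˡ-+ 2 m 1)) eq) (even≢odd (suc m) o)
2*m+n≡1+2*o⇒n≢1⇒3≤n m (suc (suc (suc n))) o _ _ = s≤s (s≤s (s≤s z≤n))

module NoOnesAtDistanceOneOrThree
  (n : ℕ) (x : ℕ → Bool) (x-periodic : Periodic n x)
  (apart-1 : ∀ i → x i ∧ x (1 + i) ≡ false)
  (apart-3 : ∀ i → x i ∧ x (3 + i) ≡ false)
  where

  ones : ℕ
  ones = ∑< n (indicator ∘ x)

  doubleZero : ℕ → Bool
  doubleZero i = not (x i ∨ x (1 + i))

  doubleZeros : ℕ
  doubleZeros = ∑< n (indicator ∘ doubleZero)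

  doubleZero-periodic : Periodic n doubleZero
  doubleZero-periodic i = cong₂ (λ a b → not (a ∨ b)) (x-periodic i) (x-periodic (1 + i))

  2*ones+doubleZeros≡n : 2 * ones + doubleZeros ≡ n
  2*ones+doubleZeros≡n = begin
    2 * ones + doubleZeros
      ≡⟨ cong (λ k → ones + k + doubleZeros) (+-identityʳ ones) ⟩
    ones + ones + doubleZeros
      ≡⟨ cong (λ k → ones + k + doubleZeros)
              (sym (∑<-shift-periodic n (indicator ∘ x) (cong indicator (x-periodic 0)))) ⟩
    ones + ∑< n (indicator ∘ x ∘ suc) + doubleZeros
      ≡⟨ cong (_+ doubleZeros) (sym (∑<-distrib-+ n (indicator ∘ x) (indicator ∘ x ∘ suc))) ⟩
    ∑< n (λ i → indicator (x i) + indicator (x (1 + i))) + doubleZeros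
      ≡⟨ sym (∑<-distrib-+ n _ (indicator ∘ doubleZero)) ⟩
    ∑< n (λ i → indicator (x i) + indicator (x (1 + i)) + indicator (doubleZero i))
      ≡⟨ ∑<-cong n (λ {i} _ → indicator-partition (x i) (x (1 + i)) (apart-1 i)) ⟩
    ∑< n (λ _ → 1)
      ≡⟨ trans (∑<-const n 1) (*-identityʳ n) ⟩
    n ∎
    where open ≡-Reasoning

  2*ones≤n : 2 * ones ≤ n
  2*ones≤n = subst (2 * ones ≤_) 2*ones+doubleZeros≡n (m≤m+n (2 * ones) doubleZeros)

  doubleZeros≢1 : 3 ≤ n → doubleZeros ≢ 1
  doubleZeros≢1 3≤n D≡1 with ∑<-pos⇒∃ n (indicator ∘ doubleZero) (≤-reflexive (sym D≡1))
  ... | j , _ , 0<dz-j = <-irrefl (sym D≡1) (begin-strict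
    1                   <⟨ +-mono-≤ 1≤g1 1≤g1 ⟩
    g 1 + g 1           ≤⟨ +-monoʳ-≤ (g 1) g1≤g0+g2 ⟩
    g 1 + (g 0 + g 2)   ≡⟨ x∙yz≈yx∙z (g 1) (g 0) (g 2) ⟩
    ∑< 3 g              ≤⟨ ∑<-monoˡ-≤ g 3≤n ⟩
    ∑< n g              ≡⟨ ∑<-rotate n (cong indicator ∘ doubleZero-periodic) m ⟩
    doubleZeros         ∎)
    where
    open ≤-Reasoning
    -- the window k ↦ k + m puts the double zero j (mod n) at position 1
    m : ℕ
    m = j + pred n
    g : ℕ → ℕ
    g k = indicator (doubleZero (k + m))
    1+m≡j+n : 1 + m ≡ j + n
    1+m≡j+n = trans (sym (+-suc j (pred n)))
                    (cong (j +_) (suc-pred n {{>-nonZero (<-≤-trans z<s 3≤n)}}))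
    1≤g1 : 1 ≤ g 1
    1≤g1 = subst (1 ≤_) (sym (cong indicator (trans (cong doubleZero 1+m≡j+n) (doubleZero-periodic j))))
                 0<dz-j
    g1≤g0+g2 : g 1 ≤ g 0 + g 2
    g1≤g0+g2 = indicator-nor-≤ (x m) (x (1 + m)) (x (2 + m)) (x (3 + m)) (apart-3 m)

  2*ones+3≤n : 3 ≤ n → Odd n → 2 * ones + 3 ≤ n
  2*ones+3≤n 3≤n (k , n≡1+2k) = subst (2 * ones + 3 ≤_) 2*ones+doubleZeros≡n
    (+-monoʳ-≤ (2 * ones) (2*m+n≡1+2*o⇒n≢1⇒3≤n ones doubleZeros k
      (trans 2*ones+doubleZeros≡n n≡1+2k) (doubleZeros≢1 3≤n)))

[m%n+k]%n≡[m+k]%n : ∀ m k n .{{_ : NonZero n}} → (m % n + k) % n ≡ (m + k) % n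
[m%n+k]%n≡[m+k]%n m k n = begin
  (m % n + k) % n            ≡⟨ %-distribˡ-+ (m % n) k n ⟩
  (m % n % n + k % n) % n    ≡⟨ cong (λ r → (r + k % n) % n) (m%n%n≡m%n m n) ⟩
  (m % n + k % n) % n        ≡⟨ sym (%-distribˡ-+ m k n) ⟩
  (m + k) % n                ∎
  where open ≡-Reasoning

[r+d]%n≢r : ∀ {r d n} .{{_ : NonZero n}} → 0 < d → d < n → r < n → (r + d) % n ≢ r
[r+d]%n≢r {r} {d} {n} 0<d d<n r<n with r + d <? n
... | yes r+d<n = λ eq → <⇒≢ (m<m+n r 0<d) (trans (sym eq) (m<n⇒m%n≡m r+d<n))
... | no  r+d≮n = λ eq → <⇒≢ r+d∸n<r (trans (sym (m<n⇒m%n≡m (<-trans r+d∸n<r r<n)))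
                                        (trans (m≤n⇒[n∸m]%m≡n%m n≤r+d) eq))
  where
  n≤r+d : n ≤ r + d
  n≤r+d = ≮⇒≥ r+d≮n
  r+d∸n<r : r + d ∸ n < r
  r+d∸n<r = subst (r + d ∸ n <_) (m+n∸n≡m r n) (∸-monoˡ-< (+-monoʳ-< r d<n) n≤r+d)

toℕ-mod : ∀ m n .{{_ : NonZero n}} → toℕ (m mod n) ≡ m % n
toℕ-mod m n = toℕ-fromℕ< (m%n<n m n)

mod-stepBy : ∀ n d i .{{_ : NonZero n}} → StepBy n d (i mod n) ((d + i) mod n)
mod-stepBy n d i = begin
  (toℕ (i mod n) + d) % n  ≡⟨ cong (λ r → (r + d) % n) (toℕ-mod i n) ⟩
  (i % n + d) % n          ≡⟨ [m%n+k]%n≡[m+k]%n i d n ⟩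
  (i + d) % n              ≡⟨ cong (_% n) (+-comm i d) ⟩
  (d + i) % n              ≡⟨ sym (toℕ-mod (d + i) n) ⟩
  toℕ ((d + i) mod n)      ∎
  where open ≡-Reasoning

mod-≢ : ∀ n d i .{{_ : NonZero n}} → 0 < d → d < n → i mod n ≢ (d + i) mod n
mod-≢ n d i 0<d d<n eq = [r+d]%n≢r 0<d d<n (m%n<n i n) (sym (begin
  i % n                    ≡⟨ sym (toℕ-mod i n) ⟩
  toℕ (i mod n)            ≡⟨ cong toℕ eq ⟩
  toℕ ((d + i) mod n)      ≡⟨ sym (mod-stepBy n d i) ⟩
  (toℕ (i mod n) + d) % n  ≡⟨ cong (λ r → (r + d) % n) (toℕ-mod i n) ⟩
  (i % n + d) % n          ∎))
  where open ≡-Reasoning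

lookupℕ : ∀ {n} → Vec Bool n → ℕ → Bool
lookupℕ []      _       = false
lookupℕ (b ∷ _) zero    = b
lookupℕ (_ ∷ v) (suc i) = lookupℕ v i

lookupℕ-toℕ : ∀ {n} (v : Vec Bool n) j → lookupℕ v (toℕ j) ≡ lookup v j
lookupℕ-toℕ (_ ∷ _) Fin.zero    = refl
lookupℕ-toℕ (_ ∷ v) (Fin.suc j) = lookupℕ-toℕ v j

∣p∣≡∑<lookupℕ : ∀ {n} (p : Subset n) → ∣ p ∣ ≡ ∑< n (indicator ∘ lookupℕ p)
∣p∣≡∑<lookupℕ []            = refl
∣p∣≡∑<lookupℕ {suc n} (b ∷ p) = trans (∣b∷p∣ b) (sym (∑<-suc n (indicator ∘ lookupℕ (b ∷ p))))
  where
  ∣b∷p∣ : ∀ b → ∣ b ∷ p ∣ ≡ indicator b + ∑< n (indicator ∘ lookupℕ p)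
  ∣b∷p∣ true  = cong suc (∣p∣≡∑<lookupℕ p)
  ∣b∷p∣ false = ∣p∣≡∑<lookupℕ p

module IndependentSetBound (n : ℕ) .{{_ : NonZero n}} (3<n : 3 < n)
  (S : Subset n) (independent : Independent n S)
  where

  occupied : ℕ → Bool
  occupied i = lookupℕ S (i % n)

  occupied⇒∈ : ∀ {i} → occupied i ≡ true → i mod n ∈ S
  occupied⇒∈ {i} eq = lookup⇒[]= (i mod n) S
    (trans (sym (lookupℕ-toℕ S (i mod n))) (trans (cong (lookupℕ S) (toℕ-mod i n)) eq))

  not-both-occupied : ∀ {i j} → Adj13 n (i mod n) (j mod n) → occupied i ∧ occupied j ≡ false
  not-both-occupied {i} {j} adj with occupied i in oi | occupied j in oj
  ... | false | _     = refl
  ... | true  | false = refl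
  ... | true  | true  = contradiction adj (independent _ _ (occupied⇒∈ oi) (occupied⇒∈ oj))

  open NoOnesAtDistanceOneOrThree n occupied
    (λ i → cong (lookupℕ S) ([m+n]%n≡m%n i n))
    (λ i → not-both-occupied (mod-≢ n 1 i z<s (<-trans (s≤s z<s) 3<n) , inj₁ (mod-stepBy n 1 i)))
    (λ i → not-both-occupied (mod-≢ n 3 i z<s 3<n , inj₂ (inj₂ (inj₁ (mod-stepBy n 3 i)))))

  ∣S∣≡ones : ∣ S ∣ ≡ ones
  ∣S∣≡ones = trans (∣p∣≡∑<lookupℕ S)
    (∑<-cong n (λ i<n → cong (indicator ∘ lookupℕ S) (sym (m<n⇒m%n≡m i<n))))

  2*∣S∣≤n : 2 * ∣ S ∣ ≤ n
  2*∣S∣≤n = subst (λ s → 2 * s ≤ n) (sym ∣S∣≡ones) 2*ones≤n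

  2*∣S∣+3≤n : Odd n → 2 * ∣ S ∣ + 3 ≤ n
  2*∣S∣+3≤n odd = subst (λ s → 2 * s + 3 ≤ n) (sym ∣S∣≡ones) (2*ones+3≤n (<⇒≤ 3<n) odd)

evens : ℕ → (n : ℕ) → Subset n
evens zero    n             = ⊥
evens (suc k) zero          = []
evens (suc k) (suc zero)    = inside ∷ []
evens (suc k) (suc (suc n)) = inside ∷ outside ∷ evens k n

∣evens∣ : ∀ k n → k + k ≤ n → ∣ evens k n ∣ ≡ k
∣evens∣ zero    n             _   = ∣⊥∣≡0 n
∣evens∣ (suc k) (suc (suc n)) 2+2k≤2+n =
  cong suc (∣evens∣ k n (s≤s⁻¹ (subst (_≤ suc n) (+-suc k k) (s≤s⁻¹ 2+2k≤2+n))))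
∣evens∣ (suc k) (suc zero)    2+2k≤1 =
  contradiction (subst (_≤ 1) (cong suc (+-suc k k)) 2+2k≤1) λ { (s≤s ()) }

∈evens⇒even : ∀ k n {j : Fin n} → j ∈ evens k n → 2 ∣ toℕ j × toℕ j < k + k
∈evens⇒even zero    n                 j∈ = contradiction j∈ ∉⊥
∈evens⇒even (suc k) (suc zero)        here = 2 ∣0 , z<s
∈evens⇒even (suc k) (suc (suc n))     here = 2 ∣0 , z<s
∈evens⇒even (suc k) (suc (suc n)) {Fin.suc (Fin.suc j)} (there (there j∈)) with ∈evens⇒even k n j∈
... | 2∣j , j<2k =
  ∣m∣n⇒∣m+n ∣-refl 2∣j , subst (2 + toℕ j <_) (sym (cong suc (+-suc k k))) (s≤s (s≤s j<2k))

even+odd≢even-mod : ∀ {a b d n} .{{_ : NonZero n}} → 2 ∣ a → 2 ∣ b → 2 ∤ d →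
  2 ∣ n ⊎ a + d < n → (a + d) % n ≢ b
even+odd≢even-mod {a} {b} {d} {n} 2∣a 2∣b 2∤d parity-kept eq =
  2∤d (∣m+n∣m⇒∣n (2∣a+d parity-kept) 2∣a)
  where
  2∣a+d : 2 ∣ n ⊎ a + d < n → 2 ∣ a + d
  2∣a+d (inj₁ 2∣n) = m%n≡0⇒n∣m (a + d) 2 (begin
    (a + d) % 2      ≡⟨ sym (m∣n⇒o%n%m≡o%m 2 n (a + d) 2∣n) ⟩
    (a + d) % n % 2  ≡⟨ cong (_% 2) eq ⟩
    b % 2            ≡⟨ n∣m⇒m%n≡0 b 2 2∣b ⟩
    0                ∎)
    where open ≡-Reasoning
  2∣a+d (inj₂ a+d<n) = subst (2 ∣_) (trans (sym eq) (m<n⇒m%n≡m a+d<n)) 2∣b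

evens-independent : ∀ k n .{{_ : NonZero n}} → 2 ∣ n ⊎ k + k + 3 ≤ n → Independent n (evens k n)
evens-independent k n fits u v u∈ v∈ (_ , steps) = no-steps steps
  where
  2∤1 : 2 ∤ 1
  2∤1 2∣1 = contradiction (n∣m⇒m%n≡0 1 2 2∣1) λ ()
  2∤3 : 2 ∤ 3
  2∤3 2∣3 = contradiction (n∣m⇒m%n≡0 3 2 2∣3) λ ()
  no-step : ∀ {a b} d → a ∈ evens k n → b ∈ evens k n → 2 ∤ d → d ≤ 3 → ¬ StepBy n d a b
  no-step d a∈ b∈ 2∤d d≤3 with ∈evens⇒even k n a∈ | ∈evens⇒even k n b∈
  ... | 2∣a , a<2k | 2∣b , _ =
    even+odd≢even-mod 2∣a 2∣b 2∤d (map₂ (<-≤-trans (+-mono-<-≤ a<2k d≤3)) fits)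
  no-steps : ¬ (StepBy n 1 u v ⊎ StepBy n 1 v u ⊎ StepBy n 3 u v ⊎ StepBy n 3 v u)
  no-steps (inj₁ step)                 = no-step 1 u∈ v∈ 2∤1 (s≤s z≤n) step
  no-steps (inj₂ (inj₁ step))          = no-step 1 v∈ u∈ 2∤1 (s≤s z≤n) step
  no-steps (inj₂ (inj₂ (inj₁ step)))   = no-step 3 u∈ v∈ 2∤3 ≤-refl step
  no-steps (inj₂ (inj₂ (inj₂ step)))   = no-step 3 v∈ u∈ 2∤3 ≤-refl step

α-even : ∀ n k .{{_ : NonZero n}} → 3 < n → n ≡ 2 * k → IndependenceNumber13 n k
α-even n k 3<n n≡2k =
  (evens k n , evens-independent k n (inj₁ 2∣n) , ∣evens∣ k n k+k≤n) ,
  λ S independent → *-cancelˡ-≤ 2 (subst (2 * ∣ S ∣ ≤_) n≡2k (2*∣S∣≤n n 3<n S independent))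
  where
  open IndependentSetBound using (2*∣S∣≤n)
  2∣n : 2 ∣ n
  2∣n = divides k (trans n≡2k (*-comm 2 k))
  k+k≤n : k + k ≤ n
  k+k≤n = ≤-reflexive (sym (trans n≡2k (cong (k +_) (+-identityʳ k))))

α-odd : ∀ n k .{{_ : NonZero n}} → 3 < n → n ≡ 3 + 2 * k → IndependenceNumber13 n k
α-odd n k 3<n n≡3+2k =
  (evens k n , evens-independent k n (inj₂ k+k+3≤n) , ∣evens∣ k n (≤-trans (m≤m+n (k + k) 3) k+k+3≤n)) ,
  λ S independent → *-cancelˡ-≤ 2 (+-cancelʳ-≤ 3 (2 * ∣ S ∣) (2 * k)
    (subst (2 * ∣ S ∣ + 3 ≤_) n≡2k+3 (2*∣S∣+3≤n n 3<n S independent odd)))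
  where
  open IndependentSetBound using (2*∣S∣+3≤n)
  n≡2k+3 : n ≡ 2 * k + 3
  n≡2k+3 = trans n≡3+2k (+-comm 3 (2 * k))
  k+k+3≤n : k + k + 3 ≤ n
  k+k+3≤n = ≤-reflexive (sym (trans n≡2k+3 (cong (_+ 3) (cong (k +_) (+-identityʳ k)))))
  odd : Odd n
  odd = suc k , trans n≡3+2k (cong suc (sym (*-suc 2 k)))

2*k/2≡k : ∀ k → 2 * k / 2 ≡ k
2*k/2≡k k = trans (cong (_/ 2) (*-comm 2 k)) (m*n/n≡m k 2)

proposition2p2 : (n : ℕ) → .{{_ : NonZero n}} → 4 ≤ n →
    (Even n → IndependenceNumber13 n (n / 2))
    × (Odd n → IndependenceNumber13 n ((n ∸ 3) / 2))
proposition2p2 n 4≤n = even-case , odd-case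
  where
  even-case : Even n → IndependenceNumber13 n (n / 2)
  even-case (k , n≡2k) = subst (IndependenceNumber13 n)
    (sym (trans (cong (_/ 2) n≡2k) (2*k/2≡k k))) (α-even n k 4≤n n≡2k)
  odd-case : Odd n → IndependenceNumber13 n ((n ∸ 3) / 2)
  odd-case (zero  , n≡1)     = contradiction (subst (4 ≤_) n≡1 4≤n) λ { (s≤s ()) }
  odd-case (suc k , n≡1+2[1+k]) = subst (IndependenceNumber13 n)
    (sym (trans (cong (λ m → (m ∸ 3) / 2) n≡3+2k) (trans (cong (_/ 2) (m+n∸m≡n 3 (2 * k))) (2*k/2≡k k))))
    (α-odd n k 4≤n n≡3+2k)
    where
    n≡3+2k : n ≡ 3 + 2 * k
    n≡3+2k = trans n≡1+2[1+k] (cong suc (*-suc 2 k))
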